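{- A set-system hypergraph $G$ is injective in $\mathfrak{H}$ (with respect to monomorphisms) if and only if $V(G)\neq\emptyset$ and $\epsilon_G^{ -1}(S)\neq\emptyset$ for all $S\in\mathcal{P}(V(G))$.
   Context: A set-system hypergraph $G$ consists of sets $V(G)$, $E(G)$ and a function $\epsilon_G:E(G)\to\mathcal{P}(V(G))$ (edges may be empty). A morphism $\phi:G\to H$ is a pair of functions $V(\phi):V(G)\to V(H)$, $E(\phi):E(G)\to E(H)$ with $\epsilon_H\circ E(\phi)=\mathcal{P}V(\phi)\circ\epsilon_G$, where $\mathcal{P}f(A)=\{f(a):a\in A\}$. This forms the category $\mathfrak{H}$. -}

module Defs where

open import Level using (Level; suc; _⊔_)
open import Data.Product using (Σ; Σ-syntax; _×_; _,_)
open import Relation.Binary.PropositionalEquality using (_≡_)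
open import Relation.Nullary using (Dec)
open import Relation.Unary using (Pred; _≐_)

-- Law of excluded middle for propositions (the paper works classically).
IsProp : ∀ {ℓ} → Set ℓ → Set ℓ
IsProp P = (x y : P) → x ≡ y

LEM : (ℓ : Level) → Set (suc ℓ)
LEM ℓ = (P : Set ℓ) → IsProp P → Dec P

image : ∀ {ℓ} {X Y : Set ℓ} → (X → Y) → Pred X ℓ → Pred Y ℓ
image {X = X} f A y = Σ[ x ∈ X ] (A x × f x ≡ y)

record Hypergraph (ℓ : Level) : Set (suc ℓ) where
  field
    V : Set ℓ
    E : Set ℓ
    ε : E → Pred V ℓ
open Hypergraph public

record Hom {ℓ} (G H : Hypergraph ℓ) : Set ℓ where
  field
    fV : V G → V H
    fE : E G → E H
    compat : ∀ e → ε H (fE e) ≐ image fV (ε G e)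
open Hom public

idH : ∀ {ℓ} {G : Hypergraph ℓ} → Hom G G
idH = record { fV = λ v → v ; fE = λ e → e
             ; compat = λ e → (λ {v} p → v , p , _≡_.refl)
                            , (λ { (v , p , _≡_.refl) → p }) }

_∘H_ : ∀ {ℓ} {A B C : Hypergraph ℓ} → Hom B C → Hom A B → Hom A C
_∘H_ {A = A} {B} {C} g f = record
  { fV = λ v → fV g (fV f v)
  ; fE = λ e → fE g (fE f e)
  ; compat = λ e →
      (λ p → let (b , q , r) = proj₁ (compat g (fE f e)) p
                 (a , s , t) = proj₁ (compat f e) q
             in a , s , trans (cong (fV g) t) r)
    , (λ { (a , s , t) → proj₂ (compat g (fE f e))
             (fV f a , proj₂ (compat f e) (a , s , refl) , t) }) }
  where
  open Data.Product using (proj₁; proj₂)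
  open Relation.Binary.PropositionalEquality using (refl; trans; cong)

_≈H_ : ∀ {ℓ} {G H : Hypergraph ℓ} → Hom G H → Hom G H → Set ℓ
φ ≈H ψ = (∀ v → fV φ v ≡ fV ψ v) × (∀ e → fE φ e ≡ fE ψ e)

IsMono : ∀ {ℓ} {A B : Hypergraph ℓ} → Hom A B → Set (suc ℓ)
IsMono {ℓ} {A} m = (T : Hypergraph ℓ) (g h : Hom T A) → (m ∘H g) ≈H (m ∘H h) → g ≈H h

Injective : ∀ {ℓ} → Hypergraph ℓ → Set (suc ℓ)
Injective {ℓ} G = (A B : Hypergraph ℓ) (m : Hom A B) → IsMono m →
  (f : Hom A G) → Σ[ g ∈ Hom B G ] ((g ∘H m) ≈H f)

module Submission where

-- The proof rests on a characterisation of monomorphisms: a morphism is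
-- mono iff its vertex and edge maps are both injective.  Injectivity of the
-- vertex map is tested against the one-vertex edgeless hypergraph; for the
-- edge map, an injective vertex map first shows that edges with the same
-- image have the same incidence set, and the "star" of such an edge then
-- admits two morphisms into the domain that m cannot distinguish.
--
-- Necessity: extending along the mono ∅ ↪ (one vertex) yields a vertex, and
-- extending the identity of V(G) along (V(G), no edges) ↪ (V(G), one edge S)
-- yields an edge with incidence set S.
-- Sufficiency: given a mono m : A → B and f : A → G, excluded middle decides
-- the (propositional) fibres of the injective maps V(m), E(m); a point or
-- edge in the image of m is sent where f sends its unique preimage, any
-- other vertex goes to a fixed vertex, and any other edge b goes to an edge
-- whose incidence set is the image of ε_B(b), which exists by assumption.

open import Defs
open import Level using (Level; Lift; lift; lower)
open import Data.Empty using (⊥; ⊥-elim)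
open import Data.Unit using (⊤; tt)
open import Data.Product using (Σ; Σ-syntax; _×_; _,_; proj₁; proj₂)
open import Function.Bundles using (_⇔_; mk⇔)
import Function.Definitions as Fn
open import Relation.Nullary using (Dec; yes; no)
open import Relation.Unary using (Pred; _⊆_; _≐_)
open import Relation.Unary.Properties using (≐-trans)
open import Relation.Binary.PropositionalEquality
  using (_≡_; refl; sym; trans; cong; subst)

module _ {ℓ : Level} where

  IsInjection : {X Y : Set ℓ} → (X → Y) → Set ℓ
  IsInjection = Fn.Injective _≡_ _≡_

  Fibre : {X Y : Set ℓ} → (X → Y) → Y → Set ℓ
  Fibre {X} f y = Σ[ x ∈ X ] (f x ≡ y)

  -- Fibres of an injection are propositions; this is what lets excluded
  -- middle (stated for propositions) decide membership in the image.
  fibre-isProp : {X Y : Set ℓ} {f : X → Y} → IsInjection f → (y : Y) →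
                 IsProp (Fibre f y)
  fibre-isProp f-inj y (x , p) (x' , p') with f-inj (trans p (sym p'))
  fibre-isProp f-inj _ (x , refl) (.x , refl) | refl = refl

  module Extension {X Y Z : Set ℓ} (m : X → Y) (m-inj : IsInjection m)
                   (inImage? : (y : Y) → Dec (Fibre m y))
                   (f : X → Z) (d : Y → Z) where

    extendAt : ∀ {y} → Dec (Fibre m y) → Z
    extendAt (yes (x , _)) = f x
    extendAt {y} (no _)    = d y

    extend : Y → Z
    extend y = extendAt (inImage? y)

    extend-on-image : ∀ x → extend (m x) ≡ f x
    extend-on-image x with inImage? (m x)
    ... | yes (x' , mx'≡mx) = cong f (m-inj mx'≡mx)
    ... | no  x∉image       = ⊥-elim (x∉image (x , refl))

  edgeless : Set ℓ → Hypergraph ℓ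
  edgeless X = record { V = X ; E = Lift ℓ ⊥ ; ε = λ () }

  vertexMap : {X : Set ℓ} {H : Hypergraph ℓ} → (X → V H) → Hom (edgeless X) H
  vertexMap g = record { fV = g ; fE = λ () ; compat = λ () }

  emptyH pointH : Hypergraph ℓ
  emptyH = edgeless (Lift ℓ ⊥)
  pointH = edgeless (Lift ℓ ⊤)

  incidence-preserved : {A B : Hypergraph ℓ} (m : Hom A B) {a : E A} {x : V A} →
                        ε A a x → ε B (fE m a) (fV m x)
  incidence-preserved m {a} {x} x∈a = proj₂ (compat m a) (x , x∈a , refl)

  incidence-reflected : {A B : Hypergraph ℓ} (m : Hom A B) → IsInjection (fV m) →
                        {a : E A} {x : V A} → ε B (fE m a) (fV m x) → ε A a x
  incidence-reflected {A} m mV-inj {a} mx∈ma with proj₁ (compat m a) mx∈ma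
  ... | y , y∈a , my≡mx = subst (ε A a) (mV-inj my≡mx) y∈a

  injective⇒mono : {A B : Hypergraph ℓ} (m : Hom A B) →
                   IsInjection (fV m) → IsInjection (fE m) → IsMono m
  injective⇒mono m mV-inj mE-inj T g h (mg≈mhV , mg≈mhE) =
    (λ v → mV-inj (mg≈mhV v)) , (λ e → mE-inj (mg≈mhE e))

  star : {A : Hypergraph ℓ} → E A → Hypergraph ℓ
  star {A} a = record { V = Σ (V A) (ε A a) ; E = Lift ℓ ⊤ ; ε = λ _ _ → Lift ℓ ⊤ }

  starHom : {A : Hypergraph ℓ} {a : E A} (a' : E A) → ε A a ≐ ε A a' →
            Hom (star {A} a) A
  starHom a' (a⊆a' , a'⊆a) = record
    { fV = proj₁
    ; fE = λ _ → a'
    ; compat = λ _ → (λ {x} x∈a' → (x , a'⊆a x∈a') , lift tt , refl)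
                   , (λ { ((x , x∈a) , _ , refl) → a⊆a' x∈a }) }

  module MonoComponents {A B : Hypergraph ℓ} (m : Hom A B) (m-mono : IsMono m) where

    fV-injective : IsInjection (fV m)
    fV-injective {a} {a'} ma≡ma' =
      proj₁ (m-mono pointH (vertexMap (λ _ → a)) (vertexMap (λ _ → a'))
                    ((λ _ → ma≡ma') , λ ())) (lift tt)

    sameImage⇒⊆ : ∀ {a a'} → fE m a ≡ fE m a' → ε A a ⊆ ε A a'
    sameImage⇒⊆ {a} ma≡ma' x∈a = incidence-reflected m fV-injective
      (subst (λ e → ε B e _) ma≡ma' (incidence-preserved m x∈a))

    fE-injective : IsInjection (fE m)
    fE-injective {a} {a'} ma≡ma' =
      proj₂ (m-mono (star {A} a) (starHom {A} a ((λ p → p) , (λ p → p)))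
                    (starHom {A} a' (sameImage⇒⊆ ma≡ma' , sameImage⇒⊆ (sym ma≡ma')))
                    ((λ _ → refl) , (λ _ → ma≡ma'))) (lift tt)

  image-of-pointwise-id : {X : Set ℓ} {h : X → X} → (∀ x → h x ≡ x) →
                          (S : Pred X ℓ) → image h S ≐ S
  image-of-pointwise-id h≡id S =
    (λ { (x , x∈S , hx≡y) → subst S (trans (sym (h≡id x)) hx≡y) x∈S })
    , (λ {x} x∈S → x , x∈S , h≡id x)

  injective⇒vertex : (G : Hypergraph ℓ) → Injective G → V G
  injective⇒vertex G G-inj =
    fV (proj₁ (G-inj emptyH pointH ∅↪pt ∅↪pt-mono (vertexMap (λ ())))) (lift tt)
    where
    ∅↪pt : Hom emptyH pointH
    ∅↪pt = vertexMap (λ ())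

    ∅↪pt-mono : IsMono ∅↪pt
    ∅↪pt-mono = injective⇒mono ∅↪pt (λ {x} _ → ⊥-elim (lower x)) (λ {e} _ → ⊥-elim (lower e))

  singleEdge : (X : Set ℓ) → Pred X ℓ → Hypergraph ℓ
  singleEdge X S = record { V = X ; E = Lift ℓ ⊤ ; ε = λ _ → S }

  injective⇒everySubsetAnEdge : (G : Hypergraph ℓ) → Injective G →
                                (S : Pred (V G) ℓ) → Σ[ e ∈ E G ] (ε G e ≐ S)
  injective⇒everySubsetAnEdge G G-inj S =
    fE g (lift tt) , ≐-trans (compat g (lift tt)) (image-of-pointwise-id g-fixes S)
    where
    inclusion : Hom (edgeless (V G)) (singleEdge (V G) S)
    inclusion = vertexMap (λ v → v)

    inclusion-mono : IsMono inclusion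
    inclusion-mono = injective⇒mono inclusion (λ p → p) (λ {e} _ → ⊥-elim (lower e))

    extension : Σ[ g ∈ Hom (singleEdge (V G) S) G ] ((g ∘H inclusion) ≈H vertexMap (λ v → v))
    extension = G-inj _ _ inclusion inclusion-mono (vertexMap (λ v → v))

    g : Hom (singleEdge (V G) S) G
    g = proj₁ extension

    g-fixes : ∀ v → fV g v ≡ v
    g-fixes = proj₁ (proj₂ extension)

  module ExtensionAlongMono (lem : LEM ℓ) (G : Hypergraph ℓ) (v₀ : V G)
           (everyEdge : (S : Pred (V G) ℓ) → Σ[ e ∈ E G ] (ε G e ≐ S))
           {A B : Hypergraph ℓ} (m : Hom A B) (m-mono : IsMono m) (f : Hom A G) where
    open MonoComponents m m-mono

    inImage? : {X Y : Set ℓ} {h : X → Y} → IsInjection h → ∀ y → Dec (Fibre h y)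
    inImage? h-inj y = lem _ (fibre-isProp h-inj y)

    open Extension (fV m) fV-injective (inImage? fV-injective) (fV f) (λ _ → v₀)
      using () renaming (extend to gV; extend-on-image to gV-on-image)

    open Extension (fE m) fE-injective (inImage? fE-injective) (fE f)
                   (λ b → proj₁ (everyEdge (image gV (ε B b))))
      using () renaming (extend to gE; extend-on-image to gE-on-image)

    -- On an edge in the image of m, g agrees with f since gV ∘ V(m) = V(f).
    compat-on-image : ∀ a → ε G (fE f a) ≐ image gV (ε B (fE m a))
    compat-on-image a = to , from
      where
      to : ε G (fE f a) ⊆ image gV (ε B (fE m a))
      to y∈fa with proj₁ (compat f a) y∈fa
      ... | x , x∈a , fx≡y = fV m x , incidence-preserved m x∈a , trans (gV-on-image x) fx≡y

      from : image gV (ε B (fE m a)) ⊆ ε G (fE f a)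
      from (z , z∈ma , gz≡y) with proj₁ (compat m a) z∈ma
      ... | x , x∈a , refl = proj₂ (compat f a) (x , x∈a , trans (sym (gV-on-image x)) gz≡y)

    compat-g : ∀ b → ε G (gE b) ≐ image gV (ε B b)
    compat-g b with inImage? fE-injective b
    ... | yes (a , refl) = compat-on-image a
    ... | no  _          = proj₂ (everyEdge (image gV (ε B b)))

    g : Hom B G
    g = record { fV = gV ; fE = gE ; compat = compat-g }

    g-extends-f : (g ∘H m) ≈H f
    g-extends-f = gV-on-image , gE-on-image

  sufficiency : LEM ℓ → (G : Hypergraph ℓ) → V G →
                ((S : Pred (V G) ℓ) → Σ[ e ∈ E G ] (ε G e ≐ S)) → Injective G
  sufficiency lem G v₀ everyEdge A B m m-mono f = g , g-extends-f
    where open ExtensionAlongMono lem G v₀ everyEdge m m-mono f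

mainTheorem3 : {ℓ : Level} → LEM ℓ → (G : Hypergraph ℓ) →
    Injective G ⇔ (V G × ((S : Pred (V G) ℓ) → Σ[ e ∈ E G ] (ε G e ≐ S)))
mainTheorem3 lem G = mk⇔
  (λ G-inj → injective⇒vertex G G-inj , injective⇒everySubsetAnEdge G G-inj)
  (λ (v₀ , everyEdge) → sufficiency lem G v₀ everyEdge)
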